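{- Suppose $\Sigma$ is a finite set of formulas and the annotated sequent $\Sigma;\Gamma\Rightarrow_s\Delta$ has an annotated $\infty$-proof that is slim and cut-free. Then there is a cut-free annotated cyclic proof of $\Sigma;\Gamma\Rightarrow_s\Delta$.
   Context: Formulas are built from propositional variables and $\bot$ by $\to$, $\Box$, $\Box^+$. An annotated sequent is $\Sigma;\Gamma\Rightarrow_s\Delta$ where $\Gamma,\Delta$ are finite multisets, $\Sigma$ a set of formulas, and $s$ is either a formula or the sign $\circ$; if $s$ is a formula then $\Box^+s\in\Delta$. Annotated rules: initial sequents $\Sigma;\Gamma,p\Rightarrow_s p,\Delta$ and $\Sigma;\Gamma,\bot\Rightarrow_s\Delta$; ($\to_L$): from $\Sigma;\Gamma,B\Rightarrow_s\Delta$ and $\Sigma;\Gamma\Rightarrow_s A,\Delta$ infer $\Sigma;\Gamma,A\to B\Rightarrow_s\Delta$; ($\to_R$): from $\Sigma;\Gamma,A\Rightarrow_s B,\Delta$ infer $\Sigma;\Gamma\Rightarrow_s A\to B,\Delta$; ($\mathsf{cut}$): from $\Sigma;\Gamma\Rightarrow_s\Delta,A$ and $\Sigma;A,\Gamma\Rightarrow_s\Delta$ infer $\Sigma;\Gamma\Rightarrow_s\Delta$; ($\Box$): from $\Sigma;\Sigma_0,\Lambda,\Pi,\Box^+\Pi\Rightarrow_\circ A$ infer $\Sigma;\Phi,\Box\Lambda,\Box^+\Pi\Rightarrow_s\Box A,\Psi$; ($\Box^+$): from left premise $\Sigma;\Sigma_0,\Lambda,\Pi,\Box^+\Pi\Rightarrow_\circ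 A$ and right premise $\Sigma;\Sigma_0,\Lambda,\Pi,\Box^+\Pi\Rightarrow_A\Box^+A$ infer $\Sigma;\Phi,\Box\Lambda,\Box^+\Pi\Rightarrow_s\Box^+A,\Psi$; $\Sigma_0$ a finite subset of $\Sigma$, $\Box\Lambda$, $\Box^+\Pi$ elementwise. An application of a modal rule is slim if $\Lambda$ and $\Pi$ have no repetitions. An annotated $\infty$-proof is a possibly infinite tree of annotated sequents built by annotated rules, all leaves annotated initial sequents, such that every infinite branch has a tail in which all sequents carry the same formula annotation and which passes through right premises of ($\Box^+$) infinitely many times; it is slim if all modal applications are slim and cut-free if it has no ($\mathsf{cut}$). An annotated cyclic proof is a pair $(\kappa,d)$ where $\kappa$ is a finite tree of annotated sequents built by annotated rules and $d$ is a function defined on exactly the leaves of $\kappa$ not marked by annotated initial sequents, such that for each such leaf $c$: $d(c)\neq c$ lies on the path from the root to $c$; $d(c)$ and $c$ are marked by the same annotated sequent; all sequents on the path from $d(c)$ to $c$ have the same annotation; and this path passes through the right premise of an application of ($\Box^+$). It is cut-free if $\kappa$ contains no ($\mathsf{cut}$). -}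

module Defs where

open import Data.Nat using (ℕ; zero; suc; _≤_)
open import Data.Fin using (Fin; zero; suc; toℕ)
open import Data.List using (List; []; _∷_; _++_; map; length; lookup; take; [_])
open import Data.List.Membership.Propositional using (_∈_)
open import Data.List.Relation.Unary.All using (All)
open import Data.List.Relation.Unary.Any using (Any)
open import Data.List.Relation.Unary.Unique.Propositional using (Unique)
open import Data.List.Relation.Binary.Permutation.Propositional using (_↭_)
open import Data.Maybe using (Maybe; just; nothing)
open import Data.Bool using (Bool; true; false)
open import Data.Product using (Σ; _×_; _,_; proj₁; proj₂; ∃-syntax)
open import Data.Sum using (_⊎_)
open import Data.Unit using (⊤)
open import Data.Empty using (⊥)
open import Relation.Nullary using (¬_)
open import Relation.Binary.PropositionalEquality using (_≡_)

infixr 20 _⇒_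
data Fm : Set where
  fvar : ℕ → Fm
  fbot : Fm
  _⇒_  : Fm → Fm → Fm
  □_   : Fm → Fm
  □⁺_  : Fm → Fm

-- Annotated sequents  Σ;Γ ⇒_s Δ.
-- Σ is fixed throughout any derivation (every rule preserves it), so it
-- is a parameter of the derivation types rather than part of Seq.
-- Multisets Γ, Δ are lists considered up to permutation (_↭_).
-- The annotation s is `nothing` for ∘ and `just A` for a formula A.

record Seq : Set where
  constructor seq
  field
    ant  : List Fm
    succ : List Fm
    ann  : Maybe Fm
open Seq public

Annotated : Seq → Set
Annotated (seq Γ Δ nothing)  = ⊤
Annotated (seq Γ Δ (just A)) = (□⁺ A) ∈ Δ

-- "marked by the same annotated sequent" (Σ is common to all sequents)
SameSeq : Seq → Seq → Set
SameSeq (seq Γ Δ s) (seq Γ' Δ' s') = (Γ ↭ Γ') × (Δ ↭ Δ') × (s ≡ s')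

data Initial : Seq → Set where
  init-p : ∀ {Γ Δ s} (Γ' Δ' : List Fm) (p : ℕ) →
           Γ ↭ fvar p ∷ Γ' → Δ ↭ fvar p ∷ Δ' → Initial (seq Γ Δ s)
  init-⊥ : ∀ {Γ Δ s} (Γ' : List Fm) →
           Γ ↭ fbot ∷ Γ' → Initial (seq Γ Δ s)

data Inf (Σf : List Fm) : Seq → List Seq → Set where
  ax    : ∀ {S} → Initial S → Inf Σf S []
  →L    : ∀ {Γ Δ s} (Γ' : List Fm) (A B : Fm) → Γ ↭ (A ⇒ B) ∷ Γ' →
          Inf Σf (seq Γ Δ s) (seq (B ∷ Γ') Δ s ∷ seq Γ' (A ∷ Δ) s ∷ [])
  →R    : ∀ {Γ Δ s} (Δ' : List Fm) (A B : Fm) → Δ ↭ (A ⇒ B) ∷ Δ' →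
          Inf Σf (seq Γ Δ s) (seq (A ∷ Γ) (B ∷ Δ') s ∷ [])
  cut   : ∀ {Γ Δ s} (A : Fm) →
          Inf Σf (seq Γ Δ s) (seq Γ (A ∷ Δ) s ∷ seq (A ∷ Γ) Δ s ∷ [])
  -- Σ₀ is a finite subset of Σ (a duplicate-free list of members of Σ)
  box   : ∀ {Γ Δ s} (Σ₀ Φ Λ Π Ψ : List Fm) (A : Fm) →
          Unique Σ₀ → All (_∈ Σf) Σ₀ →
          Γ ↭ Φ ++ map □_ Λ ++ map □⁺_ Π → Δ ↭ (□ A) ∷ Ψ →
          Inf Σf (seq Γ Δ s)
                 (seq (Σ₀ ++ Λ ++ Π ++ map □⁺_ Π) [ A ] nothing ∷ [])
  box⁺  : ∀ {Γ Δ s} (Σ₀ Φ Λ Π Ψ : List Fm) (A : Fm) →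
          Unique Σ₀ → All (_∈ Σf) Σ₀ →
          Γ ↭ Φ ++ map □_ Λ ++ map □⁺_ Π → Δ ↭ (□⁺ A) ∷ Ψ →
          Inf Σf (seq Γ Δ s)
                 (seq (Σ₀ ++ Λ ++ Π ++ map □⁺_ Π) [ A ] nothing ∷
                  seq (Σ₀ ++ Λ ++ Π ++ map □⁺_ Π) [ □⁺ A ] (just A) ∷ [])

isRight□⁺ : ∀ {Σf S ps} → Inf Σf S ps → Fin (length ps) → Bool
isRight□⁺ (box⁺ _ _ _ _ _ _ _ _ _ _) (suc zero) = true
isRight□⁺ _ _ = false

SlimRule : ∀ {Σf S ps} → Inf Σf S ps → Set
SlimRule (box  _ _ Λ Π _ _ _ _ _ _) = Unique Λ × Unique Π
SlimRule (box⁺ _ _ Λ Π _ _ _ _ _ _) = Unique Λ × Unique Π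
SlimRule _ = ⊤

CutFreeRule : ∀ {Σf S ps} → Inf Σf S ps → Set
CutFreeRule (cut _) = ⊥
CutFreeRule _ = ⊤

-- Possibly infinite trees of annotated sequents built by annotated rules.
-- (Coinduction needs --guardedness, which is not available, so a possibly
-- infinite tree is presented as a coalgebra: a type of nodes with a root,
-- each node labelled by an annotated sequent and an application of an
-- annotated rule, with one child per premise.  The tree is its unfolding
-- from the root.  Leaves are exactly the nodes whose rule has no
-- premises, i.e. (ax), so all leaves are annotated initial sequents.)

record ∞Tree (Σf : List Fm) (S : Seq) : Set₁ where
  field
    Node        : Set
    root        : Node
    label       : Node → Seq
    root-label  : label root ≡ S
    annotated   : (x : Node) → Annotated (label x)
    prems       : Node → List Seq
    rule        : (x : Node) → Inf Σf (label x) (prems x)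
    child       : (x : Node) → Fin (length (prems x)) → Node
    child-label : (x : Node) (i : Fin (length (prems x))) →
                  label (child x i) ≡ lookup (prems x) i
open ∞Tree public

data Reachable {Σf S} (π : ∞Tree Σf S) : Node π → Set where
  root-r  : Reachable π (root π)
  child-r : ∀ {x} → Reachable π x → (i : Fin (length (prems π x))) →
            Reachable π (child π x i)

record Branch {Σf : List Fm} {S : Seq} (π : ∞Tree Σf S) : Set where
  field
    nodeAt : ℕ → Node π
    dirAt  : (n : ℕ) → Fin (length (prems π (nodeAt n)))
    start  : nodeAt zero ≡ root π
    next   : (n : ℕ) → nodeAt (suc n) ≡ child π (nodeAt n) (dirAt n)
open Branch public

annAt : ∀ {Σf S} {π : ∞Tree Σf S} → Branch π → ℕ → Maybe Fm
annAt {π = π} b n = ann (label π (nodeAt b n))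

right□⁺At : ∀ {Σf S} {π : ∞Tree Σf S} → Branch π → ℕ → Bool
right□⁺At {π = π} b n = isRight□⁺ (rule π (nodeAt b n)) (dirAt b n)

GoodBranch : ∀ {Σf S} {π : ∞Tree Σf S} → Branch π → Set
GoodBranch b =
  ∃[ k ] ∃[ A ] (((n : ℕ) → k ≤ n → annAt b n ≡ just A) ×
                 ((m : ℕ) → ∃[ n ] (m ≤ n × k ≤ n × right□⁺At b n ≡ true)))

Is∞Proof : ∀ {Σf S} → ∞Tree Σf S → Set
Is∞Proof π = (b : Branch π) → GoodBranch b

Slim∞ : ∀ {Σf S} → ∞Tree Σf S → Set
Slim∞ π = (x : Node π) → Reachable π x → SlimRule (rule π x)

CutFree∞ : ∀ {Σf S} → ∞Tree Σf S → Set
CutFree∞ π = (x : Node π) → Reachable π x → CutFreeRule (rule π x)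

-- A finite tree κ together with the back-link function d is represented
-- by a finite tree whose non-initial leaves (buds) each carry a pointer
-- d(c) to a strict ancestor.  The index `anc` lists the ancestors of the
-- current node (nearest first), each with a flag recording whether the
-- edge from that ancestor towards the current node enters a right
-- premise of (□⁺).

Anc : Set
Anc = Seq × Bool

-- the companion (k-th ancestor, 0 = parent) is a valid target for bud S:
-- same annotated sequent, the path from it to the bud has constant
-- annotation, and that path passes through a right premise of (□⁺)
ValidLink : List Anc → Seq → Set
ValidLink anc S =
  Σ (Fin (length anc)) λ k →
    SameSeq (proj₁ (lookup anc k)) S ×
    All (λ e → ann (proj₁ e) ≡ ann S) (take (suc (toℕ k)) anc) ×
    Any (λ e → proj₂ e ≡ true) (take (suc (toℕ k)) anc)

data Cyc (Σf : List Fm) (anc : List Anc) : Seq → Set where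
  node : ∀ {S ps} → Annotated S → (r : Inf Σf S ps) →
         ((i : Fin (length ps)) →
            Cyc Σf ((S , isRight□⁺ r i) ∷ anc) (lookup ps i)) →
         Cyc Σf anc S
  bud  : ∀ {S} → Annotated S → ¬ Initial S → ValidLink anc S →
         Cyc Σf anc S

CutFreeCyc : ∀ {Σf anc S} → Cyc Σf anc S → Set
CutFreeCyc (node _ r ks) = CutFreeRule r × ((i : _) → CutFreeCyc (ks i))
CutFreeCyc (bud _ _ _)   = ⊤

CyclicProof : List Fm → Seq → Set
CyclicProof Σf S = Cyc Σf [] S

-- A cut-free cyclic proof is found by a bounded proof search that never consults π.
-- Up to permutation, a slim cut-free ∞-proof of Σ;Γ ⇒ Δ contains only sequents built
-- from subformulas of Γ, Δ and Σ and of bounded weight, and to each sequent only finitely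
-- many cut-free rule applications apply. A depth-first search that closes a branch by a
-- valid back-link, and gives up on it at a repetition whose back-link would be invalid,
-- therefore ends with a cyclic proof or with a refutation: every candidate rule has a
-- refuted premise. A refutation can be followed through π, since the rule π applies is
-- always among the candidates; at a given-up repetition the walk resumes with the
-- refutation of the earlier occurrence. On the resulting infinite branch the ancestors form
-- a stack of bounded height, and a return to an earlier occurrence never pops a segment of
-- constant annotation that passes a right (□⁺)-premise. So once the annotation is constant,
-- each right (□⁺)-premise raises the minimal height of the stack for good, and the branch
-- passes only finitely many of them, contradicting that π is an ∞-proof.

module Submission where

open import Defs
open import Data.Nat
  using (ℕ; zero; suc; _+_; _*_; _∸_; _≤_; _<_; _≤?_; z≤n; s≤s)
  renaming (_≟_ to _≟ℕ_)
open import Data.Nat.Properties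
  using (module ≤-Reasoning; ≤-refl; ≤-trans; ≤-pred; ≰⇒>; <-≤-trans; ≤-<-trans; n≤1+n; m≤m+n; m≤n+m;
         +-mono-≤; +-monoˡ-≤; +-monoʳ-≤; +-suc; +-identityʳ; m∸n≤m; m∸n+n≡m; ∸-monoʳ-<; <-irrefl;
         1+n≰n; 0≢1+n; m≤n⇒m<n∨m≡n)
open import Data.Nat.ListAction using (sum)
open import Data.Nat.ListAction.Properties using (sum-++; sum-↭)
open import Data.Nat.Tactic.RingSolver using (solve-∀)
open import Data.Fin using (Fin; zero; suc; toℕ)
import Data.Fin.Properties as Finₚ
open import Data.List
  using (List; []; _∷_; _++_; map; concat; concatMap; length; lookup; take; drop; [_])
open import Data.List.Properties using (length-++-≤ʳ; length-drop; length-map; map-++; ++-identityʳ)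
open import Data.List.Membership.Propositional using (_∈_; mapWith∈; lose; find)
open import Data.List.Membership.Propositional.Properties using (∈-∃++; ∈-++⁺ˡ; ∈-++⁺ʳ; ∈-++⁻; ∈-map⁺)
open import Data.List.Relation.Binary.Subset.Propositional using (_⊆_)
open import Data.List.Relation.Unary.All as All using (All; []; _∷_; all?)
open import Data.List.Relation.Unary.All.Properties using (++⁻ˡ; ++⁻ʳ)
open import Data.List.Relation.Unary.Any as Any using (Any; here; there; any?)
open import Data.List.Relation.Unary.Any.Properties as Anyₚ using (mapWith∈⁺; concat⁺; concatMap⁺)
open import Data.List.Relation.Unary.AllPairs using ([]; _∷_)
open import Data.List.Relation.Unary.Unique.Propositional using (Unique)
open import Data.List.Relation.Unary.Unique.Propositional.Properties using () renaming (map⁺ to Unique-map⁺)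
open import Data.List.Relation.Binary.Permutation.Propositional
  using (_↭_; ↭-refl; ↭-sym; ↭-trans; prep)
open import Data.List.Relation.Binary.Permutation.Propositional.Properties
  using (∈-resp-↭; shift; drop-∷; ↭-length)
  renaming (map⁺ to ↭-map⁺)
open import Data.Maybe using (Maybe; just; nothing)
open import Data.Maybe.Properties using () renaming (≡-dec to Maybe-≡-dec)
open import Data.Bool using (true)
open import Data.Bool.Properties using () renaming (_≟_ to _≟ᵇ_)
open import Data.Product using (Σ; Σ-syntax; ∃; ∃-syntax; _×_; _,_; proj₁; proj₂)
open import Data.Sum using (_⊎_; inj₁; inj₂)
open import Data.Unit using (tt)
open import Data.Empty using (⊥; ⊥-elim)
open import Relation.Nullary using (¬_; Dec; yes; no)
open import Relation.Nullary.Decidable using (_×-dec_)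
open import Relation.Binary.Definitions using (DecidableEquality)
open import Relation.Binary.PropositionalEquality
  using (_≡_; _≢_; refl; sym; trans; cong; cong₂; subst; subst₂)
open import Function using (_∘_)

whenDec : ∀ {P B : Set} → Dec P → (P → List B) → List B
whenDec (yes p) f = f p
whenDec (no _)  _ = []

Any-whenDec : ∀ {P B : Set} {Q : B → Set} (d : Dec P) {f : P → List B} →
              P → (∀ p → Any Q (f p)) → Any Q (whenDec d f)
Any-whenDec (yes p) _ any = any p
Any-whenDec (no ¬p) p _   = ⊥-elim (¬p p)

all-or-exists : ∀ {n} {P Q : Fin n → Set} → (∀ i → P i ⊎ Q i) → (∀ i → P i) ⊎ ∃ Q
all-or-exists {zero}  _ = inj₁ λ ()
all-or-exists {suc n} decide with decide zero | all-or-exists (decide ∘ suc)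
... | inj₂ q | _            = inj₂ (zero , q)
... | inj₁ p | inj₁ ps      = inj₁ λ { zero → p ; (suc i) → ps i }
... | inj₁ _ | inj₂ (i , q) = inj₂ (suc i , q)

any-concatMap : ∀ {A B : Set} {P : B → Set} (f : A → List B) {x xs} →
                x ∈ xs → Any P (f x) → Any P (concatMap f xs)
any-concatMap f x∈xs p = concatMap⁺ f (lose x∈xs p)

module _ {A : Set} where

  any-or-all : ∀ {P Q : A → Set} {xs} → All (λ x → P x ⊎ Q x) xs → Any P xs ⊎ All Q xs
  any-or-all []             = inj₂ []
  any-or-all (inj₁ p ∷ _)   = inj₁ (here p)
  any-or-all (inj₂ q ∷ pqs) with any-or-all pqs
  ... | inj₁ p  = inj₁ (there p)
  ... | inj₂ qs = inj₂ (q ∷ qs)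

  remove : ∀ {x} {xs : List A} → x ∈ xs → ∃[ ys ] xs ↭ x ∷ ys
  remove {x} x∈xs with ys , zs , refl ← ∈-∃++ x∈xs = ys ++ zs , shift x ys zs

  module _ (_≟_ : DecidableEquality A) where

    open import Data.List.Membership.DecPropositional _≟_ using (_∈?_)

    ↭-dec : (xs ys : List A) → Dec (xs ↭ ys)
    ↭-dec []       []       = yes ↭-refl
    ↭-dec []       (_ ∷ _)  = no (0≢1+n ∘ ↭-length)
    ↭-dec (x ∷ xs) ys with x ∈? ys
    ... | no x∉ys = no λ p → x∉ys (∈-resp-↭ p (here refl))
    ... | yes x∈ys with zs , ys↭ ← remove x∈ys with ↭-dec xs zs
    ...   | yes xs↭ = yes (↭-trans (prep x xs↭) (↭-sym ys↭))
    ...   | no ¬xs↭ = no λ p → ¬xs↭ (drop-∷ (↭-trans p ys↭))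

    complement? : (ys xs : List A) → Dec (∃[ zs ] xs ↭ zs ++ ys)
    complement? []       xs = yes (xs , subst (xs ↭_) (sym (++-identityʳ xs)) ↭-refl)
    complement? (y ∷ ys) xs with y ∈? xs
    ... | no y∉xs = no λ (zs , p) → y∉xs (∈-resp-↭ (↭-sym p) (∈-++⁺ʳ zs (here refl)))
    ... | yes y∈xs with xs′ , xs↭ ← remove y∈xs with complement? ys xs′
    ...   | yes (zs , p) = yes (zs , ↭-trans xs↭ (↭-trans (prep y p) (↭-sym (shift y zs ys))))
    ...   | no ¬p = no λ (zs , p) → ¬p (zs , drop-∷ (↭-trans (↭-sym xs↭) (↭-trans p (shift y zs ys))))

  listsUpTo : ℕ → List A → List (List A)
  listsUpTo zero    L = [ [] ]
  listsUpTo (suc n) L = [] ∷ concatMap (λ a → map (a ∷_) (listsUpTo n L)) L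

  ∈-listsUpTo : ∀ n {L xs : List A} → length xs ≤ n → xs ⊆ L → xs ∈ listsUpTo n L
  ∈-listsUpTo zero    {xs = []}     _          _    = here refl
  ∈-listsUpTo (suc n) {xs = []}     _          _    = here refl
  ∈-listsUpTo (suc n) {L} {x ∷ xs} (s≤s |xs|) x∷xs⊆L =
    there (concatMap⁺ (λ a → map (a ∷_) (listsUpTo n L)) (lose (x∷xs⊆L (here refl))
                            (∈-map⁺ (x ∷_) (∈-listsUpTo n |xs| (x∷xs⊆L ∘ there)))))

  -- A superset of the duplicate-free lists with entries in L.
  duplicateFreeListsOver : List A → List (List A)
  duplicateFreeListsOver L = listsUpTo (length L) L

  sum-map-⊆ : (f : A → ℕ) {xs ys : List A} → Unique xs → xs ⊆ ys → sum (map f xs) ≤ sum (map f ys)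
  sum-map-⊆ f {[]}     _          _       = z≤n
  sum-map-⊆ f {x ∷ xs} (x∉xs ∷ u) x∷xs⊆ys with zs , ys↭ ← remove (x∷xs⊆ys (here refl)) =
    subst (f x + sum (map f xs) ≤_) (sym (sum-↭ (↭-map⁺ f ys↭))) (+-monoʳ-≤ (f x) (sum-map-⊆ f u xs⊆zs))
    where
    xs⊆zs : xs ⊆ zs
    xs⊆zs y∈xs with ∈-resp-↭ ys↭ (x∷xs⊆ys (there y∈xs))
    ... | here refl = ⊥-elim (All.lookup x∉xs y∈xs refl)
    ... | there y∈zs = y∈zs

  length-⊆ : {xs ys : List A} → Unique xs → xs ⊆ ys → length xs ≤ length ys
  length-⊆ {xs} {ys} u xs⊆ys =
    subst₂ _≤_ (sum-map-const xs) (sum-map-const ys) (sum-map-⊆ (λ _ → 1) u xs⊆ys)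
    where
    sum-map-const : ∀ zs → sum (map (λ _ → 1) zs) ≡ length zs
    sum-map-const []       = refl
    sum-map-const (_ ∷ zs) = cong suc (sum-map-const zs)

  ∈-duplicateFreeListsOver : ∀ {L xs : List A} → Unique xs → xs ⊆ L → xs ∈ duplicateFreeListsOver L
  ∈-duplicateFreeListsOver u xs⊆L = ∈-listsUpTo _ (length-⊆ u xs⊆L) xs⊆L

-- Runs of bounded stacks

module _ {X : Set} where

  drop-above : ∀ i (xs ys : List X) → length ys ≤ length (drop i (xs ++ ys)) →
               ∃[ zs ] xs ≡ take i (xs ++ ys) ++ zs × drop i (xs ++ ys) ≡ zs ++ ys
  drop-above zero    xs       ys       _ = xs , refl , refl
  drop-above (suc i) []       []       _ = [] , refl , refl
  drop-above (suc i) []       (y ∷ ys) |y∷ys|≤ =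
    ⊥-elim (1+n≰n (≤-trans |y∷ys|≤ (subst (_≤ length ys) (sym (length-drop i ys)) (m∸n≤m (length ys) i))))
  drop-above (suc i) (x ∷ xs) ys       |ys|≤ with zs , xs≡ , drop≡ ← drop-above i xs ys |ys|≤ =
    zs , cong (x ∷_) xs≡ , drop≡

  data Step (P F : X → Set) (xs : List X) (e : X) (ys : List X) : Set where
    push : ys ≡ e ∷ xs → Step P F xs e ys
    pop  : ∀ i → ys ≡ drop i (e ∷ xs) →
           (All P (take i (e ∷ xs)) → ¬ Any F (take i (e ∷ xs))) → Step P F xs e ys

  Step-weaken : ∀ {P Q F : X → Set} {xs e ys} → (∀ {x} → Q x → P x) → Step P F xs e ys → Step Q F xs e ys
  Step-weaken Q⇒P (push eq)        = push eq
  Step-weaken Q⇒P (pop i eq allowed) = pop i eq (allowed ∘ All.map Q⇒P)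

  pop-above : ∀ {P F : X → Set} i xs ys → length ys ≤ length (drop i (xs ++ ys)) → All P xs →
              (All P (take i (xs ++ ys)) → ¬ Any F (take i (xs ++ ys))) →
              ∃[ zs ] drop i (xs ++ ys) ≡ zs ++ ys × All P zs × (Any F xs → Any F zs)
  pop-above i xs ys |ys|≤ Pxs allowed with zs , xs≡ , drop≡ ← drop-above i xs ys |ys|≤ =
    zs , drop≡ , ++⁻ʳ (take i (xs ++ ys)) Pxs′ , keep
    where
    Pxs′ = subst (All _) xs≡ Pxs
    keep : Any _ xs → Any _ zs
    keep Fxs with Anyₚ.++⁻ (take i (xs ++ ys)) (subst (Any _) xs≡ Fxs)
    ... | inj₁ in-prefix = ⊥-elim (allowed (++⁻ˡ (take i (xs ++ ys)) Pxs′) in-prefix)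
    ... | inj₂ in-rest   = in-rest

MinimalFrom : (ℕ → ℕ) → ℕ → Set
MinimalFrom h t = ∀ n → t ≤ n → h t ≤ h n

¬¬minimalFrom : ∀ (h : ℕ → ℕ) t₀ → ¬ (∀ t → t₀ ≤ t → ¬ MinimalFrom h t)
¬¬minimalFrom h t₀ none = descend (suc (h t₀)) t₀ ≤-refl ≤-refl
  where
  descend : ∀ bound t → t₀ ≤ t → h t < bound → ⊥
  descend (suc bound) t t₀≤t ht<bound = none t t₀≤t minimal
    where
    minimal : MinimalFrom h t
    minimal n t≤n with h t ≤? h n
    ... | yes ht≤hn = ht≤hn
    ... | no  ht≰hn = ⊥-elim (descend bound n (≤-trans t₀≤t t≤n) (<-≤-trans (≰⇒> ht≰hn) (≤-pred ht<bound)))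

module BoundedRun {X : Set} (P F : X → Set) (C : ℕ → List X) (e : ℕ → X) (k B : ℕ)
                  (step : ∀ n → k ≤ n → Step P F (C n) (e n) (C (suc n)))
                  (bounded : ∀ n → length (C n) ≤ B)
                  (P-tail : ∀ n → k ≤ n → P (e n)) where

  height : ℕ → ℕ
  height n = length (C n)

  Above : ℕ → ℕ → Set
  Above t n = ∃[ xs ] C n ≡ xs ++ C t × All P xs × (∀ m → t ≤ m → m < n → F (e m) → Any F xs)

  above : ∀ {t} → k ≤ t → MinimalFrom height t → ∀ d → Above t (d + t)
  above {t} _   _       zero    = [] , refl , [] , λ m t≤m m<t _ → ⊥-elim (<-irrefl refl (≤-<-trans t≤m m<t))
  above {t} k≤t minimal (suc d) with xs , Cn≡ , Pxs , flags ← above k≤t minimal d =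
    extend (step n (≤-trans k≤t (m≤n+m t d)))
    where
    n = d + t
    Pxs′ : All P (e n ∷ xs)
    Pxs′ = P-tail n (≤-trans k≤t (m≤n+m t d)) ∷ Pxs
    flags′ : ∀ m → t ≤ m → m < suc n → F (e m) → Any F (e n ∷ xs)
    flags′ m t≤m m<1+n Fm with m≤n⇒m<n∨m≡n (≤-pred m<1+n)
    ... | inj₁ m<n  = there (flags m t≤m m<n Fm)
    ... | inj₂ refl = here Fm
    extend : Step P F (C n) (e n) (C (suc n)) → Above t (suc n)
    extend (push Cn+1≡) = e n ∷ xs , trans Cn+1≡ (cong (e n ∷_) Cn≡) , Pxs′ , flags′
    extend (pop i Cn+1≡ allowed) =
      let zs , drop≡ , Pzs , keep = pop-above i (e n ∷ xs) (C t) floor Pxs′ (subst Allowed Cn≡ allowed)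
      in zs , trans Cn+1≡′ drop≡ , Pzs , λ m t≤m m<1+n Fm → keep (flags′ m t≤m m<1+n Fm)
      where
      Allowed : List X → Set
      Allowed ys = All P (take i (e n ∷ ys)) → ¬ Any F (take i (e n ∷ ys))
      Cn+1≡′ : C (suc n) ≡ drop i ((e n ∷ xs) ++ C t)
      Cn+1≡′ = trans Cn+1≡ (cong (λ ys → drop i (e n ∷ ys)) Cn≡)
      floor : length (C t) ≤ length (drop i ((e n ∷ xs) ++ C t))
      floor = subst (λ ys → length (C t) ≤ length ys) Cn+1≡′ (minimal (suc n) (≤-trans (m≤n+m t d) (n≤1+n n)))

  above-from : ∀ {t n} → k ≤ t → MinimalFrom height t → t ≤ n → Above t n
  above-from {t} k≤t minimal t≤n = subst (Above t) (m∸n+n≡m t≤n) (above k≤t minimal (_ ∸ t))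

  -- An F-entry pushed after a minimal time t is never popped again, so the next tail
  -- minimum lies strictly above height t; this can happen at most B times.
  climb : ∀ fuel t → B ∸ height t < fuel → k ≤ t → MinimalFrom height t →
          (∀ m → ∃[ n ] m ≤ n × k ≤ n × F (e n)) → ⊥
  climb (suc fuel) t gap<fuel k≤t minimal flagged with m , t≤m , k≤m , Fm ← flagged t =
    ¬¬minimalFrom height (suc m) λ t′ m<t′ minimal′ →
      climb fuel t′ (<-≤-trans (∸-monoʳ-< (higher t′ m<t′) (bounded t′)) (≤-pred gap<fuel))
            (≤-trans k≤m (≤-trans (n≤1+n m) m<t′)) minimal′ flagged
    where
    higher : ∀ n → m < n → height t < height n
    higher n m<n with xs , Cn≡ , _ , flags ← above-from k≤t minimal (≤-trans t≤m (≤-trans (n≤1+n m) m<n)) =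
      subst (λ ys → height t < length ys) (sym Cn≡) (longer (flags m t≤m m<n Fm))
      where
      longer : ∀ {xs ys : List X} → Any F xs → length ys < length (xs ++ ys)
      longer {_ ∷ xs} {ys} _ = s≤s (length-++-≤ʳ ys {xs})

  finitely-flagged : ¬ (∀ m → ∃[ n ] m ≤ n × k ≤ n × F (e n))
  finitely-flagged flagged =
    ¬¬minimalFrom height k λ t k≤t minimal → climb (suc (B ∸ height t)) t ≤-refl k≤t minimal flagged

_≟_ : DecidableEquality Fm
fvar m ≟ fvar n with m ≟ℕ n
... | yes refl = yes refl
... | no m≢n = no λ { refl → m≢n refl }
fbot ≟ fbot = yes refl
(A ⇒ B) ≟ (C ⇒ D) with A ≟ C | B ≟ D
... | yes refl | yes refl = yes refl
... | no A≢C | _ = no λ { refl → A≢C refl }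
... | _ | no B≢D = no λ { refl → B≢D refl }
(□ A) ≟ (□ B) with A ≟ B
... | yes refl = yes refl
... | no A≢B = no λ { refl → A≢B refl }
(□⁺ A) ≟ (□⁺ B) with A ≟ B
... | yes refl = yes refl
... | no A≢B = no λ { refl → A≢B refl }
fvar _ ≟ fbot = no λ ()
fvar _ ≟ (_ ⇒ _) = no λ ()
fvar _ ≟ (□ _) = no λ ()
fvar _ ≟ (□⁺ _) = no λ ()
fbot ≟ fvar _ = no λ ()
fbot ≟ (_ ⇒ _) = no λ ()
fbot ≟ (□ _) = no λ ()
fbot ≟ (□⁺ _) = no λ ()
(_ ⇒ _) ≟ fvar _ = no λ ()
(_ ⇒ _) ≟ fbot = no λ ()
(_ ⇒ _) ≟ (□ _) = no λ ()
(_ ⇒ _) ≟ (□⁺ _) = no λ ()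
(□ _) ≟ fvar _ = no λ ()
(□ _) ≟ fbot = no λ ()
(□ _) ≟ (_ ⇒ _) = no λ ()
(□ _) ≟ (□⁺ _) = no λ ()
(□⁺ _) ≟ fvar _ = no λ ()
(□⁺ _) ≟ fbot = no λ ()
(□⁺ _) ≟ (_ ⇒ _) = no λ ()
(□⁺ _) ≟ (□ _) = no λ ()

open import Data.List.Membership.DecPropositional _≟_ using (_∈?_)

size : Fm → ℕ
size (A ⇒ B) = suc (size A + size B)
size (□ A)   = suc (size A)
size (□⁺ A)  = suc (size A)
size _       = 1

1≤size : ∀ A → 1 ≤ size A
1≤size (fvar _) = s≤s z≤n
1≤size fbot     = s≤s z≤n
1≤size (_ ⇒ _)  = s≤s z≤n
1≤size (□ _)    = s≤s z≤n
1≤size (□⁺ _)   = s≤s z≤n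

weight : List Fm → ℕ
weight Γ = sum (map size Γ)

weight-↭ : ∀ {Γ Δ} → Γ ↭ Δ → weight Γ ≡ weight Δ
weight-↭ p = sum-↭ (↭-map⁺ size p)

weight-++ : ∀ Γ Δ → weight (Γ ++ Δ) ≡ weight Γ + weight Δ
weight-++ Γ Δ = trans (cong sum (map-++ size Γ Δ)) (sum-++ (map size Γ) (map size Δ))

length≤weight : ∀ Γ → length Γ ≤ weight Γ
length≤weight []      = z≤n
length≤weight (A ∷ Γ) = +-mono-≤ (1≤size A) (length≤weight Γ)

mutual
  subformulas : Fm → List Fm
  subformulas A = A ∷ properSubformulas A

  properSubformulas : Fm → List Fm
  properSubformulas (A ⇒ B) = subformulas A ++ subformulas B
  properSubformulas (□ A)   = subformulas A
  properSubformulas (□⁺ A)  = subformulas A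
  properSubformulas _       = []

⇒ˡ∈subformulas : ∀ A B → A ∈ subformulas (A ⇒ B)
⇒ˡ∈subformulas A B = there (here refl)

⇒ʳ∈subformulas : ∀ A B → B ∈ subformulas (A ⇒ B)
⇒ʳ∈subformulas A B = there (∈-++⁺ʳ (subformulas A) (here refl))

subformulas-trans : ∀ {A B} → A ∈ subformulas B → subformulas A ⊆ subformulas B
subformulas-trans (here refl) = λ C∈ → C∈
subformulas-trans {B = B ⇒ C} (there A∈) with ∈-++⁻ (subformulas B) A∈
... | inj₁ A∈B = there ∘ ∈-++⁺ˡ ∘ subformulas-trans A∈B
... | inj₂ A∈C = there ∘ ∈-++⁺ʳ (subformulas B) ∘ subformulas-trans A∈C
subformulas-trans {B = □ B}  (there A∈) = there ∘ subformulas-trans A∈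
subformulas-trans {B = □⁺ B} (there A∈) = there ∘ subformulas-trans A∈

SameSeq-refl : ∀ S → SameSeq S S
SameSeq-refl (seq _ _ _) = ↭-refl , ↭-refl , refl

SameSeq-reflexive : ∀ {S T} → S ≡ T → SameSeq S T
SameSeq-reflexive {S} refl = SameSeq-refl S

SameSeq-trans : ∀ {S T U} → SameSeq S T → SameSeq T U → SameSeq S U
SameSeq-trans {seq _ _ _} {seq _ _ _} {seq _ _ _} (p , q , r) (p′ , q′ , r′) =
  ↭-trans p p′ , ↭-trans q q′ , trans r r′

SameSeq-ann : ∀ {S T} → SameSeq S T → ann S ≡ ann T
SameSeq-ann {seq _ _ _} {seq _ _ _} (_ , _ , r) = r

SameSeq? : (S T : Seq) → Dec (SameSeq S T)
SameSeq? (seq Γ Δ s) (seq Γ′ Δ′ s′) =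
  ↭-dec _≟_ Γ Γ′ ×-dec ↭-dec _≟_ Δ Δ′ ×-dec Maybe-≡-dec _≟_ s s′

Annotated-resp : ∀ {S T} → SameSeq S T → Annotated T → Annotated S
Annotated-resp {seq _ _ nothing}  {seq _ _ _} (_ , _ , refl) _   = tt
Annotated-resp {seq _ _ (just _)} {seq _ _ _} (_ , q , refl) □⁺A = ∈-resp-↭ (↭-sym q) □⁺A

Annotated? : ∀ S → Dec (Annotated S)
Annotated? (seq _ _ nothing)  = yes tt
Annotated? (seq _ Δ (just A)) = (□⁺ A) ∈? Δ

Initial-resp : ∀ {S T} → SameSeq S T → Initial T → Initial S
Initial-resp {seq _ _ _} {seq _ _ _} (p , q , refl) (init-p Γ′ Δ′ n p′ q′) =
  init-p Γ′ Δ′ n (↭-trans p p′) (↭-trans q q′)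
Initial-resp {seq _ _ _} {seq _ _ _} (p , q , refl) (init-⊥ Γ′ p′) =
  init-⊥ Γ′ (↭-trans p p′)

AtomIn : List Fm → Fm → Set
AtomIn Δ (fvar n) = fvar n ∈ Δ
AtomIn Δ _        = ⊥

AtomIn? : ∀ Δ A → Dec (AtomIn Δ A)
AtomIn? Δ (fvar n) = fvar n ∈? Δ
AtomIn? Δ fbot     = no λ ()
AtomIn? Δ (_ ⇒ _)  = no λ ()
AtomIn? Δ (□ _)    = no λ ()
AtomIn? Δ (□⁺ _)   = no λ ()

Initial? : ∀ S → Dec (Initial S)
Initial? (seq Γ Δ s) with fbot ∈? Γ | any? (AtomIn? Δ) Γ
... | yes ⊥∈Γ | _ = yes (init-⊥ _ (proj₂ (remove ⊥∈Γ)))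
... | no _ | yes shared with find shared
...   | fvar n , n∈Γ , n∈Δ = yes (init-p _ _ n (proj₂ (remove n∈Γ)) (proj₂ (remove n∈Δ)))
Initial? (seq Γ Δ s) | no ⊥∉Γ | no ¬shared = no λ where
  (init-p _ _ n p q) → ¬shared (lose (∈-resp-↭ (↭-sym p) (here refl)) (∈-resp-↭ (↭-sym q) (here refl)))
  (init-⊥ _ p)       → ⊥∉Γ (∈-resp-↭ (↭-sym p) (here refl))

Repeats : List Anc → Seq → Set
Repeats anc S = Σ[ j ∈ Fin (length anc) ] SameSeq (proj₁ (lookup anc j)) S

Repeats? : ∀ anc S → Dec (Repeats anc S)
Repeats? anc S = Finₚ.any? λ j → SameSeq? (proj₁ (lookup anc j)) S

¬Repeats⇒distinct : ∀ {anc S} → ¬ Repeats anc S → All (S ≢_) (map proj₁ anc)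
¬Repeats⇒distinct {[]}      _        = []
¬Repeats⇒distinct {e ∷ anc} ¬repeats =
  (λ S≡ → ¬repeats (zero , SameSeq-reflexive (sym S≡))) ∷ ¬Repeats⇒distinct (λ (j , T≈S) → ¬repeats (suc j , T≈S))

ValidLink? : ∀ anc S → Dec (ValidLink anc S)
ValidLink? anc S = Finₚ.any? λ k →
  SameSeq? (proj₁ (lookup anc k)) S ×-dec
  all? (λ e → Maybe-≡-dec _≟_ (ann (proj₁ e)) (ann S)) (take (suc (toℕ k)) anc) ×-dec
  any? (λ e → proj₂ e ≟ᵇ true) (take (suc (toℕ k)) anc)

-- The finite universe of sequents

seqWeight : Seq → ℕ
seqWeight S = weight (ant S) + weight (succ S)

→L-weightˡ : ∀ {Γ Γ′ Δ A B} → Γ ↭ (A ⇒ B) ∷ Γ′ → weight (B ∷ Γ′) + weight Δ ≤ weight Γ + weight Δ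
→L-weightˡ {Γ′ = Γ′} {Δ} {A} {B} p rewrite weight-↭ p =
  +-monoˡ-≤ (weight Δ) (+-monoˡ-≤ (weight Γ′) (≤-trans (m≤n+m (size B) (size A)) (n≤1+n _)))

→L-weightʳ : ∀ {Γ Γ′ Δ A B} → Γ ↭ (A ⇒ B) ∷ Γ′ → weight Γ′ + weight (A ∷ Δ) ≤ weight Γ + weight Δ
→L-weightʳ {Γ′ = Γ′} {Δ} {A} {B} p rewrite weight-↭ p =
  subst (weight Γ′ + (size A + weight Δ) ≤_)
        (sym (shuffle (size A) (size B) (weight Γ′) (weight Δ))) (m≤m+n _ _)
  where shuffle : ∀ a b g d → suc (a + b) + g + d ≡ g + (a + d) + suc b
        shuffle = solve-∀

→R-weight : ∀ {Γ Δ Δ′ A B} → Δ ↭ (A ⇒ B) ∷ Δ′ → weight (A ∷ Γ) + weight (B ∷ Δ′) ≤ weight Γ + weight Δ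
→R-weight {Γ} {Δ′ = Δ′} {A} {B} p rewrite weight-↭ p =
  subst (size A + weight Γ + (size B + weight Δ′) ≤_)
        (sym (shuffle (size A) (size B) (weight Γ) (weight Δ′))) (n≤1+n _)
  where shuffle : ∀ a b g d → g + (suc (a + b) + d) ≡ suc (a + g + (b + d))
        shuffle = solve-∀

module Universe (Σf : List Fm) (S₀ : Seq) where

  roots : List Fm
  roots = ant S₀ ++ succ S₀ ++ Σf

  Sub : List Fm
  Sub = concatMap subformulas roots

  Sub-closed : ∀ {A B} → A ∈ subformulas B → B ∈ Sub → A ∈ Sub
  Sub-closed A∈B B∈Sub =
    concatMap⁺ subformulas (Any.map (λ B∈C → subformulas-trans B∈C A∈B)
                                    (Anyₚ.concatMap⁻ subformulas {xs = roots} B∈Sub))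

  root∈Sub : ∀ {A} → A ∈ roots → A ∈ Sub
  root∈Sub A∈roots = any-concatMap subformulas A∈roots (here refl)

  -- Non-modal premises weigh no more than their conclusion; the antecedent of a slim modal
  -- premise consists of four duplicate-free lists over Sub, and its succedent of one formula.
  maxWeight : ℕ
  maxWeight = seqWeight S₀ + 5 * weight Sub

  record Bounded (S : Seq) : Set where
    field
      ant⊆Sub  : ant S ⊆ Sub
      succ⊆Sub : succ S ⊆ Sub
      weight≤  : seqWeight S ≤ maxWeight
  open Bounded

  Bounded-resp : ∀ {S T} → SameSeq S T → Bounded T → Bounded S
  Bounded-resp {seq Γ Δ _} {seq Γ′ Δ′ _} (Γ↭ , Δ↭ , _) b = record
    { ant⊆Sub  = ant⊆Sub b ∘ ∈-resp-↭ Γ↭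
    ; succ⊆Sub = succ⊆Sub b ∘ ∈-resp-↭ Δ↭
    ; weight≤  = subst (_≤ maxWeight) (sym (cong₂ _+_ (weight-↭ Γ↭) (weight-↭ Δ↭))) (weight≤ b)
    }

  Bounded-root : Bounded S₀
  Bounded-root = record
    { ant⊆Sub  = root∈Sub ∘ ∈-++⁺ˡ
    ; succ⊆Sub = root∈Sub ∘ ∈-++⁺ʳ (ant S₀) ∘ ∈-++⁺ˡ
    ; weight≤  = m≤m+n (seqWeight S₀) _
    }

  Bounded-modal : ∀ {Γ Φ Σ₀ Λ Π B s} → Unique Σ₀ → All (_∈ Σf) Σ₀ → Unique Λ → Unique Π →
                  Γ ⊆ Sub → Γ ↭ Φ ++ map □_ Λ ++ map □⁺_ Π → B ∈ Sub →
                  Bounded (seq (Σ₀ ++ Λ ++ Π ++ map □⁺_ Π) [ B ] s)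
  Bounded-modal {Γ} {Φ} {Σ₀} {Λ} {Π} {B} uΣ₀ Σ₀⊆Σ uΛ uΠ Γ⊆ p B∈Sub = record
    { ant⊆Sub  = ant⊆
    ; succ⊆Sub = λ { (here refl) → B∈Sub }
    ; weight≤  = ≤-trans total (m≤n+m _ (seqWeight S₀))
    }
    where
    boxed⊆ : Φ ++ map □_ Λ ++ map □⁺_ Π ⊆ Sub
    boxed⊆ = Γ⊆ ∘ ∈-resp-↭ (↭-sym p)
    Σ₀⊆ : Σ₀ ⊆ Sub
    Σ₀⊆ = root∈Sub ∘ ∈-++⁺ʳ (ant S₀) ∘ ∈-++⁺ʳ (succ S₀) ∘ All.lookup Σ₀⊆Σ
    Λ⊆ : Λ ⊆ Sub
    Λ⊆ A∈Λ = Sub-closed (there (here refl)) (boxed⊆ (∈-++⁺ʳ Φ (∈-++⁺ˡ (∈-map⁺ □_ A∈Λ))))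
    □⁺Π⊆ : map □⁺_ Π ⊆ Sub
    □⁺Π⊆ = boxed⊆ ∘ ∈-++⁺ʳ Φ ∘ ∈-++⁺ʳ (map □_ Λ)
    Π⊆ : Π ⊆ Sub
    Π⊆ A∈Π = Sub-closed (there (here refl)) (□⁺Π⊆ (∈-map⁺ □⁺_ A∈Π))
    ant⊆ : Σ₀ ++ Λ ++ Π ++ map □⁺_ Π ⊆ Sub
    ant⊆ A∈ with ∈-++⁻ Σ₀ A∈
    ... | inj₁ A∈Σ₀ = Σ₀⊆ A∈Σ₀
    ... | inj₂ A∈ with ∈-++⁻ Λ A∈
    ...   | inj₁ A∈Λ = Λ⊆ A∈Λ
    ...   | inj₂ A∈ with ∈-++⁻ Π A∈
    ...     | inj₁ A∈Π = Π⊆ A∈Π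
    ...     | inj₂ A∈□⁺Π = □⁺Π⊆ A∈□⁺Π
    w = weight Sub
    total : weight (Σ₀ ++ Λ ++ Π ++ map □⁺_ Π) + weight [ B ] ≤ 5 * w
    total = begin
      weight (Σ₀ ++ Λ ++ Π ++ map □⁺_ Π) + weight [ B ]
        ≡⟨ cong (_+ weight [ B ]) (weight-++₄ Σ₀ Λ Π (map □⁺_ Π)) ⟩
      (weight Σ₀ + (weight Λ + (weight Π + weight (map □⁺_ Π)))) + (size B + 0)
        ≤⟨ +-mono-≤ (+-mono-≤ (sum-map-⊆ size uΣ₀ Σ₀⊆)
                    (+-mono-≤ (sum-map-⊆ size uΛ Λ⊆)
                    (+-mono-≤ (sum-map-⊆ size uΠ Π⊆)
                              (sum-map-⊆ size (Unique-map⁺ □⁺-injective uΠ) □⁺Π⊆))))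
                    (sum-map-⊆ size {ys = Sub} ([] ∷ []) λ { (here refl) → B∈Sub }) ⟩
      (w + (w + (w + w))) + w
        ≡⟨ five w ⟩
      5 * w ∎
      where
      open ≤-Reasoning
      weight-++₄ : ∀ as bs cs ds →
                   weight (as ++ bs ++ cs ++ ds) ≡ weight as + (weight bs + (weight cs + weight ds))
      weight-++₄ as bs cs ds =
        trans (weight-++ as _) (cong (weight as +_)
          (trans (weight-++ bs _) (cong (weight bs +_) (weight-++ cs ds))))
      □⁺-injective : ∀ {A C} → □⁺ A ≡ □⁺ C → A ≡ C
      □⁺-injective refl = refl
      five : ∀ w → (w + (w + (w + w))) + w ≡ 5 * w
      five = solve-∀

  Bounded-premise : ∀ {S ps} (r : Inf Σf S ps) → CutFreeRule r → SlimRule r → Bounded S →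
                    (i : Fin (length ps)) → Bounded (lookup ps i)
  Bounded-premise {seq Γ Δ _} (→L Γ′ A B p) _ _ b zero = record
    { ant⊆Sub  = λ { (here refl) → Sub-closed (⇒ʳ∈subformulas A B) A⇒B∈Sub
                   ; (there C∈) → ant⊆Sub b (∈-resp-↭ (↭-sym p) (there C∈)) }
    ; succ⊆Sub = succ⊆Sub b
    ; weight≤  = ≤-trans (→L-weightˡ {Δ = Δ} p) (weight≤ b)
    }
    where A⇒B∈Sub = ant⊆Sub b (∈-resp-↭ (↭-sym p) (here refl))
  Bounded-premise {seq Γ Δ _} (→L Γ′ A B p) _ _ b (suc zero) = record
    { ant⊆Sub  = λ C∈ → ant⊆Sub b (∈-resp-↭ (↭-sym p) (there C∈))
    ; succ⊆Sub = λ { (here refl) → Sub-closed (⇒ˡ∈subformulas A B) A⇒B∈Sub ; (there C∈) → succ⊆Sub b C∈ }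
    ; weight≤  = ≤-trans (→L-weightʳ {Δ = Δ} p) (weight≤ b)
    }
    where A⇒B∈Sub = ant⊆Sub b (∈-resp-↭ (↭-sym p) (here refl))
  Bounded-premise {seq Γ Δ _} (→R Δ′ A B p) _ _ b zero = record
    { ant⊆Sub  = λ { (here refl) → Sub-closed (⇒ˡ∈subformulas A B) A⇒B∈Sub ; (there C∈) → ant⊆Sub b C∈ }
    ; succ⊆Sub = λ { (here refl) → Sub-closed (⇒ʳ∈subformulas A B) A⇒B∈Sub
                   ; (there C∈) → succ⊆Sub b (∈-resp-↭ (↭-sym p) (there C∈)) }
    ; weight≤  = ≤-trans (→R-weight {Γ = Γ} p) (weight≤ b)
    }
    where A⇒B∈Sub = succ⊆Sub b (∈-resp-↭ (↭-sym p) (here refl))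
  Bounded-premise (box Σ₀ Φ Λ Π Ψ A u Σ₀⊆Σ p q) _ (uΛ , uΠ) b zero =
    Bounded-modal {Φ = Φ} u Σ₀⊆Σ uΛ uΠ (ant⊆Sub b) p A∈Sub
    where A∈Sub = Sub-closed (there (here refl)) (succ⊆Sub b (∈-resp-↭ (↭-sym q) (here refl)))
  Bounded-premise (box⁺ Σ₀ Φ Λ Π Ψ A u Σ₀⊆Σ p q) _ (uΛ , uΠ) b zero =
    Bounded-modal {Φ = Φ} u Σ₀⊆Σ uΛ uΠ (ant⊆Sub b) p A∈Sub
    where A∈Sub = Sub-closed (there (here refl)) (succ⊆Sub b (∈-resp-↭ (↭-sym q) (here refl)))
  Bounded-premise (box⁺ Σ₀ Φ Λ Π Ψ A u Σ₀⊆Σ p q) _ (uΛ , uΠ) b (suc zero) =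
    Bounded-modal {Φ = Φ} u Σ₀⊆Σ uΛ uΠ (ant⊆Sub b) p (succ⊆Sub b (∈-resp-↭ (↭-sym q) (here refl)))

  universe : List Seq
  universe = concatMap (λ Γ → concatMap (λ Δ → map (seq Γ Δ) (nothing ∷ map just Sub)) lists) lists
    where lists = listsUpTo maxWeight Sub

  ∈-universe : ∀ {S} → Bounded S → Annotated S → S ∈ universe
  ∈-universe {seq Γ Δ s} b annotated =
    any-concatMap _ (∈-listsUpTo maxWeight |Γ|≤ (ant⊆Sub b))
      (any-concatMap _ (∈-listsUpTo maxWeight |Δ|≤ (succ⊆Sub b))
        (∈-map⁺ (seq Γ Δ) (annotation∈ s annotated)))
    where
    |Γ|≤ = ≤-trans (length≤weight Γ) (≤-trans (m≤m+n _ _) (weight≤ b))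
    |Δ|≤ = ≤-trans (length≤weight Δ) (≤-trans (m≤n+m _ _) (weight≤ b))
    annotation∈ : ∀ s → Annotated (seq Γ Δ s) → s ∈ nothing ∷ map just Sub
    annotation∈ nothing  _    = here refl
    annotation∈ (just A) □⁺A∈ = there (∈-map⁺ just (Sub-closed (there (here refl)) (succ⊆Sub b □⁺A∈)))

-- Candidate rule applications

open import Data.List.Relation.Unary.Unique.DecPropositional _≟_ using (unique?)

module Candidates (Σf : List Fm) where

  record Candidate (S : Seq) : Set where
    constructor candidate
    field
      premises : List Seq
      rule     : Inf Σf S premises
      cut-free : CutFreeRule rule
  open Candidate public

  Matches : ∀ {S S′ ps′} → Candidate S → Inf Σf S′ ps′ → Set
  Matches {ps′ = ps′} c r′ =
    (i : Fin (length (premises c))) → Σ[ i′ ∈ Fin (length ps′) ]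
      SameSeq (lookup (premises c) i) (lookup ps′ i′) × isRight□⁺ (rule c) i ≡ isRight□⁺ r′ i′

  →L-candidates : ∀ {Γ Δ s A} → A ∈ Γ → List (Candidate (seq Γ Δ s))
  →L-candidates {A = A ⇒ B} A⇒B∈Γ = [ candidate _ (→L _ A B (proj₂ (remove A⇒B∈Γ))) tt ]
  →L-candidates _ = []

  →R-candidates : ∀ {Γ Δ s A} → A ∈ Δ → List (Candidate (seq Γ Δ s))
  →R-candidates {A = A ⇒ B} A⇒B∈Δ = [ candidate _ (→R _ A B (proj₂ (remove A⇒B∈Δ))) tt ]
  →R-candidates _ = []

  ModalContext : (Γ Σ₀ Λ Π : List Fm) → Set
  ModalContext Γ Σ₀ Λ Π = Unique Σ₀ × All (_∈ Σf) Σ₀ × ∃[ Φ ] Γ ↭ Φ ++ map □_ Λ ++ map □⁺_ Π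

  ModalContext? : ∀ Γ Σ₀ Λ Π → Dec (ModalContext Γ Σ₀ Λ Π)
  ModalContext? Γ Σ₀ Λ Π =
    unique? Σ₀ ×-dec all? (_∈? Σf) Σ₀ ×-dec complement? _≟_ (map □_ Λ ++ map □⁺_ Π) Γ

  modal-candidates : ∀ {Γ Δ s} (Σ₀ Λ Π : List Fm) {A} → A ∈ Δ → List (Candidate (seq Γ Δ s))
  modal-candidates {Γ} Σ₀ Λ Π {□ A} □A∈Δ = whenDec (ModalContext? Γ Σ₀ Λ Π) λ (u , Σ₀⊆Σ , Φ , p) →
    [ candidate _ (box Σ₀ Φ Λ Π _ A u Σ₀⊆Σ p (proj₂ (remove □A∈Δ))) tt ]
  modal-candidates {Γ} Σ₀ Λ Π {□⁺ A} □⁺A∈Δ = whenDec (ModalContext? Γ Σ₀ Λ Π) λ (u , Σ₀⊆Σ , Φ , p) →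
    [ candidate _ (box⁺ Σ₀ Φ Λ Π _ A u Σ₀⊆Σ p (proj₂ (remove □⁺A∈Δ))) tt ]
  modal-candidates _ _ _ _ = []

  boxedPool : List Fm → List (List Fm)
  boxedPool Γ = duplicateFreeListsOver (concatMap subformulas Γ)

  all-modal-candidates : ∀ Γ Δ s → List (Candidate (seq Γ Δ s))
  all-modal-candidates Γ Δ s =
    concatMap (λ Σ₀ → concatMap (λ Λ → concatMap (λ Π → concat (mapWith∈ Δ (modal-candidates Σ₀ Λ Π)))
                                                 (boxedPool Γ))
                                (boxedPool Γ))
              (duplicateFreeListsOver Σf)

  candidates : (S : Seq) → List (Candidate S)
  candidates (seq Γ Δ s) =
    concat (mapWith∈ Γ →L-candidates) ++ concat (mapWith∈ Δ →R-candidates) ++ all-modal-candidates Γ Δ s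

  modal-complete : ∀ {Γ Δ s Σ₀ Λ Π Φ A} {P : Candidate (seq Γ Δ s) → Set} →
                   Unique Σ₀ → All (_∈ Σf) Σ₀ → Unique Λ → Unique Π → Γ ↭ Φ ++ map □_ Λ ++ map □⁺_ Π →
                   (A∈Δ : A ∈ Δ) → Any P (modal-candidates Σ₀ Λ Π A∈Δ) → Any P (all-modal-candidates Γ Δ s)
  modal-complete {Γ} {Δ} {Σ₀ = Σ₀} {Λ} {Π} {Φ} u Σ₀⊆Σ uΛ uΠ p A∈Δ P-cand =
    any-concatMap _ (∈-duplicateFreeListsOver u (All.lookup Σ₀⊆Σ))
      (any-concatMap _ (∈-duplicateFreeListsOver uΛ Λ⊆)
        (any-concatMap _ (∈-duplicateFreeListsOver uΠ Π⊆)
          (concat⁺ (mapWith∈⁺ (modal-candidates Σ₀ Λ Π) (_ , A∈Δ , P-cand)))))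
    where
    Λ⊆ : Λ ⊆ concatMap subformulas Γ
    Λ⊆ B∈Λ = any-concatMap subformulas (∈-resp-↭ (↭-sym p) (∈-++⁺ʳ Φ (∈-++⁺ˡ (∈-map⁺ □_ B∈Λ)))) (there (here refl))
    Π⊆ : Π ⊆ concatMap subformulas Γ
    Π⊆ B∈Π = any-concatMap subformulas
               (∈-resp-↭ (↭-sym p) (∈-++⁺ʳ Φ (∈-++⁺ʳ (map □_ Λ) (∈-map⁺ □⁺_ B∈Π)))) (there (here refl))

  candidates-complete : ∀ {S S′ ps′} (r′ : Inf Σf S′ ps′) → CutFreeRule r′ → SlimRule r′ →
             SameSeq S S′ → ¬ Initial S → Any (λ c → Matches c r′) (candidates S)
  candidates-complete (ax init) _ _ S≈ ¬init = ⊥-elim (¬init (Initial-resp S≈ init))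
  candidates-complete (cut _) () _ _ _
  candidates-complete {seq Γ Δ s} {seq _ _ _} (→L Γ′ A B p) _ _ (Γ↭ , Δ↭ , refl) _ =
    Anyₚ.++⁺ˡ (concat⁺ (mapWith∈⁺ →L-candidates (_ , A⇒B∈Γ , here matches)))
    where
    A⇒B∈Γ = ∈-resp-↭ (↭-sym Γ↭) (∈-resp-↭ (↭-sym p) (here refl))
    rest↭ : proj₁ (remove A⇒B∈Γ) ↭ Γ′
    rest↭ = drop-∷ (↭-trans (↭-sym (proj₂ (remove A⇒B∈Γ))) (↭-trans Γ↭ p))
    matches : Matches {seq Γ Δ s} (candidate _ (→L _ A B (proj₂ (remove A⇒B∈Γ))) tt) (→L Γ′ A B p)
    matches zero       = zero , (prep B rest↭ , Δ↭ , refl) , refl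
    matches (suc zero) = suc zero , (rest↭ , prep A Δ↭ , refl) , refl
  candidates-complete {seq Γ Δ s} {seq _ _ _} (→R Δ′ A B p) _ _ (Γ↭ , Δ↭ , refl) _ =
    Anyₚ.++⁺ʳ (concat (mapWith∈ Γ →L-candidates))
      (Anyₚ.++⁺ˡ (concat⁺ (mapWith∈⁺ →R-candidates (_ , A⇒B∈Δ , here matches))))
    where
    A⇒B∈Δ = ∈-resp-↭ (↭-sym Δ↭) (∈-resp-↭ (↭-sym p) (here refl))
    rest↭ : proj₁ (remove A⇒B∈Δ) ↭ Δ′
    rest↭ = drop-∷ (↭-trans (↭-sym (proj₂ (remove A⇒B∈Δ))) (↭-trans Δ↭ p))
    matches : Matches {seq Γ Δ s} (candidate _ (→R _ A B (proj₂ (remove A⇒B∈Δ))) tt) (→R Δ′ A B p)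
    matches zero = zero , (prep A Γ↭ , prep B rest↭ , refl) , refl
  candidates-complete {seq Γ Δ s} {seq _ _ _} (box Σ₀ Φ Λ Π Ψ A u Σ₀⊆Σ p q) _ (uΛ , uΠ) (Γ↭ , Δ↭ , refl) _ =
    Anyₚ.++⁺ʳ (concat (mapWith∈ Γ →L-candidates)) (Anyₚ.++⁺ʳ (concat (mapWith∈ Δ →R-candidates))
      (modal-complete {Φ = Φ} u Σ₀⊆Σ uΛ uΠ Γ↭Φ++ □A∈Δ
        (Any-whenDec (ModalContext? Γ Σ₀ Λ Π) (u , Σ₀⊆Σ , Φ , Γ↭Φ++)
          λ _ → here λ { zero → zero , SameSeq-refl _ , refl })))
    where
    Γ↭Φ++ = ↭-trans Γ↭ p
    □A∈Δ = ∈-resp-↭ (↭-sym Δ↭) (∈-resp-↭ (↭-sym q) (here refl))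
  candidates-complete {seq Γ Δ s} {seq _ _ _} (box⁺ Σ₀ Φ Λ Π Ψ A u Σ₀⊆Σ p q) _ (uΛ , uΠ) (Γ↭ , Δ↭ , refl) _ =
    Anyₚ.++⁺ʳ (concat (mapWith∈ Γ →L-candidates)) (Anyₚ.++⁺ʳ (concat (mapWith∈ Δ →R-candidates))
      (modal-complete {Φ = Φ} u Σ₀⊆Σ uΛ uΠ Γ↭Φ++ □⁺A∈Δ
        (Any-whenDec (ModalContext? Γ Σ₀ Λ Π) (u , Σ₀⊆Σ , Φ , Γ↭Φ++)
          λ _ → here λ { zero       → zero , SameSeq-refl _ , refl
                       ; (suc zero) → suc zero , SameSeq-refl _ , refl })))
    where
    Γ↭Φ++ = ↭-trans Γ↭ p
    □⁺A∈Δ = ∈-resp-↭ (↭-sym Δ↭) (∈-resp-↭ (↭-sym q) (here refl))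

-- Bounded proof search: a cyclic proof or a refutation

module Search (Σf : List Fm) (depth : ℕ) where
  open Candidates Σf

  CutFreeCyclic : List Anc → Seq → Set
  CutFreeCyclic anc S = Σ[ κ ∈ Cyc Σf anc S ] CutFreeCyc κ

  mutual
    data Refutation (anc : List Anc) (S : Seq) : Set where
      not-annotated : ¬ Annotated S → Refutation anc S
      bad-repeat    : ¬ ValidLink anc S → Repeats anc S → Refutation anc S
      too-deep      : length anc ≡ depth → Refutation anc S
      expanded      : Expanded anc S → Refutation anc S

    record Expanded (anc : List Anc) (S : Seq) : Set where
      inductive
      field
        ¬initial : ¬ Initial S
        ¬repeats : ¬ Repeats anc S
        refuted  : All (λ c → Σ[ i ∈ Fin (length (premises c)) ]
                          Refutation ((S , isRight□⁺ (rule c) i) ∷ anc) (lookup (premises c) i))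
                       (candidates S)

  search : ∀ fuel anc S → fuel + length anc ≡ depth → CutFreeCyclic anc S ⊎ Refutation anc S
  search fuel anc S _ with Annotated? S
  ... | no ¬annotated = inj₂ (not-annotated ¬annotated)
  ... | yes annotated with Initial? S
  ... | yes initial = inj₁ (node annotated (ax initial) (λ ()) , tt , λ ())
  ... | no ¬initial with ValidLink? anc S
  ... | yes link = inj₁ (bud annotated ¬initial link , tt)
  ... | no ¬link with Repeats? anc S
  ... | yes repeats = inj₂ (bad-repeat ¬link repeats)
  search zero anc S fuel-eq | yes _ | no _ | no _ | no _ = inj₂ (too-deep fuel-eq)
  search (suc fuel) anc S fuel-eq | yes annotated | no ¬initial | no _ | no ¬repeats
    with any-or-all (All.tabulate λ {c} _ → all-or-exists λ i →
           search fuel ((S , isRight□⁺ (rule c) i) ∷ anc) (lookup (premises c) i)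
                  (trans (+-suc fuel (length anc)) fuel-eq))
  ... | inj₁ proved with c , proofs ← Any.satisfied proved =
    inj₁ (node annotated (rule c) (proj₁ ∘ proofs) , cut-free c , proj₂ ∘ proofs)
  ... | inj₂ refuted =
    inj₂ (expanded (record { ¬initial = ¬initial ; ¬repeats = ¬repeats ; refuted = refuted }))

-- Following a refutation through the ∞-proof

Flagged : Anc → Set
Flagged e = proj₂ e ≡ true

AnnotatedAs : Maybe Fm → Anc → Set
AnnotatedAs s e = ann (proj₁ e) ≡ s

module Run (Σf : List Fm) (S₀ : Seq) (π : ∞Tree Σf S₀) (slim : Slim∞ π) (cutFree : CutFree∞ π) where
  open Candidates Σf
  open Universe Σf S₀

  -- Exceeds the height of every Stack, so too-deep refutations never occur along π.
  depth : ℕ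
  depth = suc (length universe)

  open Search Σf depth

  search-from-root : CutFreeCyclic [] S₀ ⊎ Refutation [] S₀
  search-from-root = search depth [] S₀ (+-identityʳ depth)

  data Stack : List Anc → Set where
    []   : Stack []
    push : ∀ {anc S} b → S ∈ universe → Expanded anc S → Stack anc → Stack ((S , b) ∷ anc)

  Stack-lookup : ∀ {anc} → Stack anc → (j : Fin (length anc)) →
                 Expanded (drop (suc (toℕ j)) anc) (proj₁ (lookup anc j)) × Stack (drop (suc (toℕ j)) anc)
  Stack-lookup (push _ _ ex st) zero    = ex , st
  Stack-lookup (push _ _ _  st) (suc j) = Stack-lookup st j

  Stack-length≤ : ∀ {anc} → Stack anc → length anc ≤ length universe
  Stack-length≤ {anc} st =
    subst (_≤ length universe) (length-map proj₁ anc) (length-⊆ (distinct st) (⊆universe st))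
    where
    distinct : ∀ {anc} → Stack anc → Unique (map proj₁ anc)
    distinct []                = []
    distinct (push _ _ ex st) = ¬Repeats⇒distinct (Expanded.¬repeats ex) ∷ distinct st
    ⊆universe : ∀ {anc} → Stack anc → map proj₁ anc ⊆ universe
    ⊆universe (push _ S∈ _ _)  (here refl) = S∈
    ⊆universe (push _ _ _ st) (there T∈)  = ⊆universe st T∈

  Bounded-reachable : ∀ {x} → Reachable π x → Bounded (label π x)
  Bounded-reachable root-r = subst Bounded (sym (root-label π)) Bounded-root
  Bounded-reachable (child-r {x} r i) =
    subst Bounded (sym (child-label π x i))
          (Bounded-premise (rule π x) (cutFree x r) (slim x r) (Bounded-reachable r) i)

  record State (y : Node π) : Set where
    constructor state
    field
      reachable : Reachable π y
      ancestors : List Anc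
      stack     : Stack ancestors
      sequent   : Seq
      sequent≈  : SameSeq sequent (label π y)
      expansion : Expanded ancestors sequent
  open State

  entry : ∀ {y} → State y → Fin (length (prems π y)) → Anc
  entry {y} a i = sequent a , isRight□⁺ (rule π y) i

  Successor : ∀ {y} → State y → Fin (length (prems π y)) → Set
  Successor {y} a i = Σ[ a′ ∈ State (child π y i) ]
    Step (AnnotatedAs (ann (sequent a′))) Flagged (ancestors a) (entry a i) (ancestors a′)

  push-current : ∀ {y} (a : State y) i → Stack (entry a i ∷ ancestors a)
  push-current {y} a i = push _ current∈universe (expansion a) (stack a)
    where
    current∈universe = ∈-universe (Bounded-resp (sequent≈ a) (Bounded-reachable (reachable a)))
                                  (Annotated-resp (sequent≈ a) (annotated π y))

  continue : ∀ {y} (a : State y) (i : Fin (length (prems π y))) {S′} → SameSeq S′ (label π (child π y i)) →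
             Refutation (entry a i ∷ ancestors a) S′ → Successor a i
  continue a i S′≈ (not-annotated ¬annotated) = ⊥-elim (¬annotated (Annotated-resp S′≈ (annotated π _)))
  continue a i S′≈ (too-deep length≡) =
    ⊥-elim (1+n≰n (subst (_≤ length universe) length≡ (Stack-length≤ (push-current a i))))
  continue a i {S′} S′≈ (expanded ex) = state (child-r (reachable a) i) _ (push-current a i) S′ S′≈ ex , push refl
  -- Resume the refutation of the earlier occurrence T of S′: as the back-link to T is
  -- invalid, the popped segment changes annotation or passes no right (□⁺)-premise.
  continue a i S′≈ (bad-repeat ¬link (j , T≈S′)) =
    let ex , st = Stack-lookup (push-current a i) j
    in state (child-r (reachable a) i) _ st _ (SameSeq-trans T≈S′ S′≈) ex ,
       pop (suc (toℕ j)) refl λ all-ann any-flag →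
         ¬link (j , T≈S′ , All.map (λ e≡ → trans e≡ (SameSeq-ann T≈S′)) all-ann , any-flag)

  advance : ∀ {y} (a : State y) → Σ[ i ∈ Fin (length (prems π y)) ] Successor a i
  advance {y} a
    with (i , refuted-i) , matches ← All.lookupAny (Expanded.refuted (expansion a))
           (candidates-complete (rule π y) (cutFree y (reachable a)) (slim y (reachable a))
                                (sequent≈ a) (Expanded.¬initial (expansion a)))
    with i′ , premise≈ , flag≡ ← matches i =
    i′ , continue a i′ (SameSeq-trans premise≈ (SameSeq-reflexive (sym (child-label π y i′))))
                       (subst (λ b → Refutation ((sequent a , b) ∷ ancestors a) _) flag≡ refuted-i)

  Point : Set
  Point = Σ (Node π) State

  run : State (root π) → ℕ → Point
  run a₀ zero    = root π , a₀
  run a₀ (suc n) = let (y , a) = run a₀ n in child π y (proj₁ (advance a)) , proj₁ (proj₂ (advance a))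

  branch : State (root π) → Branch π
  branch a₀ = record
    { nodeAt = λ n → proj₁ (run a₀ n)
    ; dirAt  = λ n → proj₁ (advance (proj₂ (run a₀ n)))
    ; start  = refl
    ; next   = λ n → refl
    }

  bad-branch : (a₀ : State (root π)) → ¬ GoodBranch (branch a₀)
  bad-branch a₀ (k , A , ann≡ , flagged) =
    BoundedRun.finitely-flagged (AnnotatedAs (just A)) Flagged (ancestors ∘ at) entry-at k (length universe)
      (λ n k≤n → Step-weaken (λ e≡ → trans e≡ (sym (ann-at (suc n) (≤-trans k≤n (n≤1+n n)))))
                             (proj₂ (proj₂ (advance (at n)))))
      (λ n → Stack-length≤ (stack (at n)))
      ann-at
      flagged
    where
    at : (n : ℕ) → State (proj₁ (run a₀ n))
    at n = proj₂ (run a₀ n)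
    entry-at : ℕ → Anc
    entry-at n = entry (at n) (proj₁ (advance (at n)))
    ann-at : ∀ n → k ≤ n → ann (sequent (at n)) ≡ just A
    ann-at n k≤n = trans (SameSeq-ann (sequent≈ (at n))) (ann≡ n k≤n)

  root-state : Refutation [] S₀ → State (root π)
  root-state (not-annotated ¬annotated) =
    ⊥-elim (¬annotated (subst Annotated (root-label π) (annotated π (root π))))
  root-state (expanded ex) = state root-r [] [] S₀ (SameSeq-reflexive (sym (root-label π))) ex

lemma22 : (Σf : List Fm) (S : Seq) (π : ∞Tree Σf S) →
          Is∞Proof π → Slim∞ π → CutFree∞ π →
          Σ[ κ ∈ CyclicProof Σf S ] CutFreeCyc κ
lemma22 Σf S π is∞ slim cutFree with Run.search-from-root Σf S π slim cutFree
... | inj₁ proof      = proof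
... | inj₂ refutation = ⊥-elim (bad-branch a₀ (is∞ (branch a₀)))
  where
  open Run Σf S π slim cutFree
  a₀ = root-state refutation
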